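{- Let $\mathcal F$ be a signature with a well-founded precedence $>$, and let $\ell,\ell'\ge 1$ be naturals. For the relation $>_\ell$ on terms and sequences of terms over $\mathcal F$ (defined in the context): (1) If $a >_\ell b$ and $\ell \le \ell'$, then $a >_{\ell'} b$. (2) If $a >_\ell a'$, then $b \mathbin{+\!\!+} a \mathbin{+\!\!+} c >_\ell b \mathbin{+\!\!+} a' \mathbin{+\!\!+} c$ for all sequences $b, c$. (3) If $s$ is a term, $s >_\ell b$ holds by clause (ii) of the definition, $b = b_0 \mathbin{+\!\!+} b_1$ with $b_0 \neq [\,]$ and $b_1 \neq [\,]$, then $[s] \mathbin{+\!\!+} c >_\ell b_0 \mathbin{+\!\!+} c \mathbin{+\!\!+} b_1$ holds by clause (iii) of the definition, for every sequence $c$.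
   Context: Terms over $\mathcal F$ (and variables) are formed as usual; $s \rhd t$ means $t$ is a proper subterm of $s$. A precedence is a well-founded strict partial order $>$ on $\mathcal F$; constructor symbols are assumed $>$-minimal. A sequence is an expression $[t_1\cdots t_k]$ ($k\ge 0$) of terms $t_i$ (formally $\circ(t_1,\dots,t_k)$ for an auxiliary variadic symbol $\circ\notin\mathcal F$); $[\,]$ is the empty sequence and $\mathbin{+\!\!+}$ is concatenation, where in a concatenation a single term $t$ is read as $[t]$. Letters $a,b,c$ range over terms and sequences. For $\ell\ge1$, $a >_\ell b$ holds iff one of: (i) $a=f(s_1,\dots,s_k)$, $b=g(t_1,\dots,t_l)$ with $f,g\in\mathcal F$, $f>g$, $a \rhd t_j$ for all $j\in\{1,\dots,l\}$, and $l\le\ell$; (ii) $a=f(s_1,\dots,s_k)$ with $f\in\mathcal F$, $b=[t_1\cdots t_l]$, $a>_\ell t_j$ for all $j\in\{1,\dots,l\}$, and $l\le \ell$; (iii) $a=[s_1\cdots s_k]$, $b=[t_1\cdots t_l]$ and there are a permutation $\pi$ of $\{1,\dots,l\}$ and terms or sequences $b_1,\dots,b_k$ with $b_1\mathbin{+\!\!+}\cdots\mathbin{+\!\!+} b_k=[t_{\pi(1)}\cdots t_{\pi(l)}]$, $s_j \ge_\ell b_j$ for all $j$, and $s_i>_\ell b_i$ for some $i$. Here $\ge_\ell$ means $>_\ell$ or equal. -}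

module Defs where

open import Data.Nat using (ℕ; _≤_)
open import Data.Product using (_×_; _,_)
open import Data.List using (List; []; _∷_; _++_; length; map; concatMap; zip)
open import Data.List.Relation.Unary.All using (All)
open import Data.List.Relation.Unary.Any using (Any)
open import Data.List.Relation.Binary.Pointwise using (Pointwise)
open import Data.List.Relation.Binary.Permutation.Propositional using (_↭_)
open import Data.Vec using (Vec)
import Data.Vec.Relation.Unary.All as VAll
open import Data.Vec.Membership.Propositional using () renaming (_∈_ to _∈ᵥ_)
open import Relation.Binary.PropositionalEquality using (_≡_)

module _ (F V : Set) (ar : F → ℕ) where

  data Term : Set where
    var : V → Term
    fun : (f : F) → Vec Term (ar f) → Term

  data _▷_ : Term → Term → Set where
    arg  : ∀ {f ts t} → t ∈ᵥ ts → fun f ts ▷ t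
    deep : ∀ {f ts u t} → u ∈ᵥ ts → u ▷ t → fun f ts ▷ t

  -- Expressions: terms or sequences [t₁ ⋯ tₖ] (= ∘(t₁,…,tₖ)).
  data Expr : Set where
    term : Term → Expr
    seq  : List Term → Expr

  -- reading of an expression inside a concatenation (a term t is read as [t])
  toSeq : Expr → List Term
  toSeq (term t) = t ∷ []
  toSeq (seq ts) = ts

module _ {F V : Set} {ar : F → ℕ} (_≻_ : F → F → Set) where

  data Gt (ℓ : ℕ) : Expr F V ar → Expr F V ar → Set
  data Ge (ℓ : ℕ) : Expr F V ar → Expr F V ar → Set

  data Gt ℓ where
    clause-i   : ∀ {f ss g ts} → f ≻ g
               → VAll.All (λ t → _▷_ F V ar (fun f ss) t) ts
               → ar g ≤ ℓ
               → Gt ℓ (term (fun f ss)) (term (fun g ts))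
    clause-ii  : ∀ {f ss} {ts : List (Term F V ar)}
               → All (λ t → Gt ℓ (term (fun f ss)) (term t)) ts
               → length ts ≤ ℓ
               → Gt ℓ (term (fun f ss)) (seq ts)
    clause-iii : ∀ {ss ts : List (Term F V ar)} (bs : List (Expr F V ar))
               → concatMap (toSeq F V ar) bs ↭ ts
               → Pointwise (Ge ℓ) (map term ss) bs
               → Any (λ p → Gt ℓ (Data.Product.proj₁ p) (Data.Product.proj₂ p)) (zip (map term ss) bs)
               → Gt ℓ (seq ss) (seq ts)

  data Ge ℓ where
    ge-eq : ∀ {a b} → a ≡ b → Ge ℓ a b
    ge-gt : ∀ {a b} → Gt ℓ a b → Ge ℓ a b

module Submission where

-- (1) Monotonicity in ℓ: the bound ℓ only appears in side conditions of the
--     form "… ≤ ℓ", so a derivation of a >_ℓ b is turned into one of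
--     a >_ℓ′ b by weakening those conditions, by mutual induction over the
--     relations >_ℓ and ≥_ℓ.
-- (2) Compatibility with contexts: first every a >_ℓ a′ is read as a
--     comparison of sequences toSeq a >_ℓ toSeq a′ (for a term this is the
--     clause (iii) decomposition [a′]); then a clause (iii) comparison is
--     framed by b ++ _ ++ c, extending its decomposition by the singletons
--     of b and c, which are compared with themselves by ≥_ℓ.
-- (3) Absorption: if s >_ℓ a′ then [s] ++ c >_ℓ t for every rearrangement
--     t of toSeq a′ ++ c, using the decomposition a′, c₁, …, cₘ; the
--     statement is the instance t = b₀ ++ c ++ b₁ with a′ = [b₀ ++ b₁].
-- None of this uses the properties of the precedence, ℓ ≥ 1, or the
-- non-emptiness of b₀ and b₁; those hypotheses of lemma1 are carried along.

open import Defs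
open import Data.Nat using (ℕ; _≤_)
open import Data.Nat.Properties using (≤-trans)
open import Data.Product using (_×_; _,_; proj₁; proj₂)
open import Data.List using (List; []; _∷_; _++_; map; concatMap; zip)
open import Data.List.Properties using (map-++; concatMap-++; concatMap-map; concatMap-pure; ++-assoc; ++-identityʳ)
open import Data.List.Relation.Unary.All using (All; []; _∷_)
open import Data.List.Relation.Unary.Any using (Any; here; there)
open import Data.List.Relation.Binary.Pointwise using (Pointwise; []; _∷_) renaming (++⁺ to pointwise-++)
open import Data.List.Relation.Binary.Pointwise.Properties using () renaming (refl to pointwise-refl)
open import Data.List.Relation.Binary.Permutation.Propositional using (_↭_; ↭-reflexive; ↭-trans)
open import Data.List.Relation.Binary.Permutation.Propositional.Properties using (++⁺ˡ; ++⁺ʳ; ++-comm)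
open import Function using (flip)
open import Relation.Binary.PropositionalEquality using (_≡_; _≢_; refl; sym; trans; cong; cong₂; subst; module ≡-Reasoning)
open import Relation.Binary.Structures using (IsStrictPartialOrder)
open import Induction.WellFounded using (WellFounded)

module _ {A B : Set} {P : A × B → Set} where

  any-zip-++ʳ : ∀ {xs ys} (xs′ : List A) (ys′ : List B)
              → Any P (zip xs ys) → Any P (zip (xs ++ xs′) (ys ++ ys′))
  any-zip-++ʳ {_ ∷ _} {_ ∷ _} xs′ ys′ (here p)  = here p
  any-zip-++ʳ {_ ∷ _} {_ ∷ _} xs′ ys′ (there p) = there (any-zip-++ʳ xs′ ys′ p)

module _ {A : Set} {P : A × A → Set} where

  any-zip-++ˡ : ∀ {xs ys} (zs : List A)
              → Any P (zip xs ys) → Any P (zip (zs ++ xs) (zs ++ ys))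
  any-zip-++ˡ []       p = p
  any-zip-++ˡ (_ ∷ zs) p = there (any-zip-++ˡ zs p)

module _ {F V : Set} {ar : F → ℕ} (_≻_ : F → F → Set) where

  private
    Tm  = Term F V ar
    Exp = Expr F V ar

  ⟦_⟧ : Exp → List Tm
  ⟦_⟧ = toSeq F V ar

  StrictPair : ℕ → Exp × Exp → Set
  StrictPair ℓ p = Gt _≻_ ℓ (proj₁ p) (proj₂ p)

  module _ {ℓ ℓ′ : ℕ} (ℓ≤ℓ′ : ℓ ≤ ℓ′) where

    gt-mono        : ∀ {a b} → Gt _≻_ ℓ a b → Gt _≻_ ℓ′ a b
    gt-mono-all    : ∀ {a us} → All (λ t → Gt _≻_ ℓ a (term t)) us
                   → All (λ t → Gt _≻_ ℓ′ a (term t)) us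
    ge-mono-pw     : ∀ {as bs} → Pointwise (Ge _≻_ ℓ) as bs → Pointwise (Ge _≻_ ℓ′) as bs
    strict-mono    : ∀ {ps} → Any (StrictPair ℓ) ps → Any (StrictPair ℓ′) ps

    gt-mono (clause-i f≻g sub ar≤ℓ)   = clause-i f≻g sub (≤-trans ar≤ℓ ℓ≤ℓ′)
    gt-mono (clause-ii gts len≤ℓ)     = clause-ii (gt-mono-all gts) (≤-trans len≤ℓ ℓ≤ℓ′)
    gt-mono (clause-iii bs perm ge gt) = clause-iii bs perm (ge-mono-pw ge) (strict-mono gt)

    gt-mono-all []         = []
    gt-mono-all (g ∷ gs)   = gt-mono g ∷ gt-mono-all gs

    ge-mono-pw []              = []
    ge-mono-pw (ge-eq e ∷ ges) = ge-eq e ∷ ge-mono-pw ges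
    ge-mono-pw (ge-gt g ∷ ges) = ge-gt (gt-mono g) ∷ ge-mono-pw ges

    strict-mono (here g)  = here (gt-mono g)
    strict-mono (there p) = there (strict-mono p)

  ge-refl-pw : ∀ {ℓ} (as : List Exp) → Pointwise (Ge _≻_ ℓ) as as
  ge-refl-pw _ = pointwise-refl (ge-eq refl)

  flatten-terms : (c : List Tm) → concatMap ⟦_⟧ (map term c) ≡ c
  flatten-terms c = trans (concatMap-map ⟦_⟧ term c) (concatMap-pure c)

  absorb : ∀ {ℓ s a′ ts} (c : List Tm) → Gt _≻_ ℓ (term s) a′
         → ⟦ a′ ⟧ ++ c ↭ ts → Gt _≻_ ℓ (seq (s ∷ c)) (seq ts)
  absorb {a′ = a′} c s>a′ perm =
    clause-iii (a′ ∷ map term c)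
      (↭-trans (↭-reflexive (cong (⟦ a′ ⟧ ++_) (flatten-terms c))) perm)
      (ge-gt s>a′ ∷ ge-refl-pw (map term c))
      (here s>a′)

  -- Every comparison a >_ℓ a′ is also one between the sequences ⟦ a ⟧, ⟦ a′ ⟧.
  -- (A sequence is never above a term, so no further case arises.)
  as-sequences : ∀ {ℓ} {a a′ : Exp} → Gt _≻_ ℓ a a′ → Gt _≻_ ℓ (seq ⟦ a ⟧) (seq ⟦ a′ ⟧)
  as-sequences {a = term s} {a′} s>a′ = absorb [] s>a′ (↭-reflexive (++-identityʳ ⟦ a′ ⟧))
  as-sequences {a = seq ss} g@(clause-iii _ _ _ _) = g

  flatten-frame : (b : List Tm) (bs : List Exp) (c : List Tm)
                → concatMap ⟦_⟧ (map term b ++ bs ++ map term c) ≡ b ++ concatMap ⟦_⟧ bs ++ c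
  flatten-frame b bs c = begin
      concatMap ⟦_⟧ (map term b ++ bs ++ map term c)
    ≡⟨ concatMap-++ ⟦_⟧ (map term b) (bs ++ map term c) ⟩
      concatMap ⟦_⟧ (map term b) ++ concatMap ⟦_⟧ (bs ++ map term c)
    ≡⟨ cong₂ _++_ (flatten-terms b) (concatMap-++ ⟦_⟧ bs (map term c)) ⟩
      b ++ concatMap ⟦_⟧ bs ++ concatMap ⟦_⟧ (map term c)
    ≡⟨ cong (λ z → b ++ concatMap ⟦_⟧ bs ++ z) (flatten-terms c) ⟩
      b ++ concatMap ⟦_⟧ bs ++ c
    ∎
    where open ≡-Reasoning

  frame : ∀ {ℓ ss ts} (b c : List Tm)
        → Gt _≻_ ℓ (seq ss) (seq ts) → Gt _≻_ ℓ (seq (b ++ ss ++ c)) (seq (b ++ ts ++ c))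
  frame {ℓ} {ss} b c (clause-iii bs perm ge gt) =
    clause-iii (map term b ++ bs ++ map term c)
      (↭-trans (↭-reflexive (flatten-frame b bs c)) (++⁺ˡ b (++⁺ʳ c perm)))
      (subst (λ xs → Pointwise (Ge _≻_ ℓ) xs _) (sym sources)
        (pointwise-++ (ge-refl-pw (map term b)) (pointwise-++ ge (ge-refl-pw (map term c)))))
      (subst (λ xs → Any (StrictPair ℓ) (zip xs _)) (sym sources)
        (any-zip-++ˡ (map term b) (any-zip-++ʳ (map term c) (map term c) gt)))
    where
      sources : map term (b ++ ss ++ c) ≡ map term b ++ map term ss ++ map term c
      sources = trans (map-++ term b (ss ++ c)) (cong (map term b ++_) (map-++ term ss c))

lemma1 : (F V : Set) (ar : F → ℕ) (_≻_ : F → F → Set)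
    → IsStrictPartialOrder _≡_ _≻_
    → WellFounded (flip _≻_)
    → (ℓ ℓ′ : ℕ) → 1 ≤ ℓ → 1 ≤ ℓ′
    → ((a b : Expr F V ar) → Gt _≻_ ℓ a b → ℓ ≤ ℓ′ → Gt _≻_ ℓ′ a b)
    × ((a a′ : Expr F V ar) → Gt _≻_ ℓ a a′
    → (b c : List (Term F V ar))
    → Gt _≻_ ℓ (seq (b ++ toSeq F V ar a ++ c)) (seq (b ++ toSeq F V ar a′ ++ c)))
    × ((s : Term F V ar) (b₀ b₁ : List (Term F V ar))
    → Gt _≻_ ℓ (term s) (seq (b₀ ++ b₁))
    → b₀ ≢ [] → b₁ ≢ []
    → (c : List (Term F V ar))
    → Gt _≻_ ℓ (seq (s ∷ [] ++ c)) (seq (b₀ ++ c ++ b₁)))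
lemma1 F V ar _≻_ _ _ ℓ ℓ′ _ _ =
    (λ a b a>b ℓ≤ℓ′ → gt-mono _≻_ ℓ≤ℓ′ a>b)
  , (λ a a′ a>a′ b c → frame _≻_ b c (as-sequences _≻_ a>a′))
  , (λ s b₀ b₁ s>b _ _ c → absorb _≻_ c s>b (move-c b₀ b₁ c))
  where
    move-c : (b₀ b₁ c : List (Term F V ar)) → (b₀ ++ b₁) ++ c ↭ b₀ ++ c ++ b₁
    move-c b₀ b₁ c = ↭-trans (↭-reflexive (++-assoc b₀ b₁ c)) (++⁺ˡ b₀ (++-comm b₁ c))
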